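{- Let $a, r \ge 3$ be fixed integers. There is a value $n_0(a,r)$ such that for every $n \ge n_0(a,r)$ and every graph $G$ of order $n$ and radius $r$ with $W(G)<\binom{n}{2}+a n$, there is a vertex $v$ of $G$ such that $G - v$ has radius $r$ and the distance between any two vertices of $G-v$ in $G-v$ equals their distance in $G$.
   Context: $W(G)=\sum_{\{u,v\}\subset V} d(u,v)$ over unordered pairs of distinct vertices; the radius is $\min_v\max_u d(v,u)$; $G-v$ denotes the graph obtained by deleting $v$. -}

module Defs where

open import Data.Bool using (Bool; true; false; _∧_; _∨_; if_then_else_)
open import Data.Nat using (ℕ; zero; suc; pred; _+_; _⊔_; _⊓_; _<ᵇ_)
open import Data.Fin using (Fin; zero; suc; toℕ; punchIn; _≟_)
open import Data.List using (List; []; _∷_; foldr; map)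
open import Data.Nat.ListAction using (sum)
open import Data.List.Base using (allFin)
open import Data.Product using (∃)
open import Relation.Binary.PropositionalEquality using (_≡_)
open import Relation.Nullary using (does)

record Graph (n : ℕ) : Set where
  field
    adj    : Fin n → Fin n → Bool
    sym    : ∀ u v → adj u v ≡ adj v u
    irrefl : ∀ u → adj u u ≡ false
open Graph public

anyV : ∀ {n} → (Fin n → Bool) → Bool
anyV {n} p = foldr (λ x b → p x ∨ b) false (allFin n)

-- reach G k u v = true  iff  there is a walk of length ≤ k from u to v
reach : ∀ {n} → Graph n → ℕ → Fin n → Fin n → Bool
reach G zero    u v = does (u ≟ v)
reach G (suc k) u v = reach G k u v ∨ anyV (λ w → reach G k u w ∧ adj G w v)

Connected : ∀ {n} → Graph n → Set
Connected G = ∀ u v → ∃ λ k → reach G k u v ≡ true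

searchDist : ∀ {n} → Graph n → Fin n → Fin n → (fuel start : ℕ) → ℕ
searchDist G u v zero       k = k
searchDist G u v (suc fuel) k =
  if reach G k u v then k else searchDist G u v fuel (suc k)

-- graph distance d(u,v): the least length of a u–v walk.
-- (For connected graphs on n vertices this is < n, so fuel n suffices.)
dist : ∀ {n} → Graph n → Fin n → Fin n → ℕ
dist {n} G u v = searchDist G u v n 0

maxList minList : List ℕ → ℕ
maxList = foldr _⊔_ 0
minList []       = 0
minList (x ∷ xs) = foldr _⊓_ x xs

ecc : ∀ {n} → Graph n → Fin n → ℕ
ecc {n} G u = maxList (map (dist G u) (allFin n))

radius : ∀ {n} → Graph n → ℕ
radius {n} G = minList (map (ecc G) (allFin n))

-- "G has radius r" (radius is infinite for disconnected graphs)
record HasRadius {n : ℕ} (G : Graph n) (r : ℕ) : Set where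
  field
    connected : Connected G
    radius≡   : radius G ≡ r

wiener : ∀ {n} → Graph n → ℕ
wiener {n} G =
  sum (map (λ u → sum (map (λ w → if toℕ u <ᵇ toℕ w then dist G u w else 0)
                             (allFin n)))
           (allFin n))

skip : ∀ {n} → Fin n → Fin (pred n) → Fin n
skip {suc m} v x = punchIn v x

_─_ : ∀ {n} → Graph n → Fin n → Graph (pred n)
_─_ {suc m} G v = record
  { adj    = λ x y → adj G (punchIn v x) (punchIn v y)
  ; sym    = λ x y → sym G (punchIn v x) (punchIn v y)
  ; irrefl = λ x → irrefl G (punchIn v x)
  }

-- Let codeg x be the number of non-neighbours of x. A non-adjacent pair contributes at least 2
-- to W(G), so W(G) < C(n,2) + an forces Σ codeg < 2an. Deleting v preserves all distances as
-- soon as any two non-adjacent neighbours of v have a second common neighbour, and then it also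
-- preserves the radius unless v is a centre or the unique farthest vertex from some vertex.
-- Every v failing these conditions lies in a short list. If v is the only common neighbour of
-- non-adjacent p and y, then deg p ≤ codeg y + 1 and deg y ≤ codeg p + 1; so either p or y has
-- degree ≤ K and v is among its few neighbours, or one of them is sparse (codeg ≥ (n − 2)/2) and
-- the other deficient (codeg ≥ K), and v is their chosen common neighbour. A unique farthest
-- vertex v from u is at distance ≥ r ≥ 3, so its neighbours are non-neighbours of u: either u is
-- deficient and v is its chosen farthest vertex, or v has degree < K. At most 4a + 1 vertices
-- are sparse and fewer than 2an/K are deficient, so for K ≈ 32a² and large n the list has fewer
-- than n − 1 entries.

module Submission where

open import Defs hiding (sym)
open import Data.Bool using (Bool; true; false; _∧_; _∨_; not; if_then_else_)
import Data.Bool as Bool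
open import Data.Bool.Properties using (not-¬; ¬-not; ⇔→≡)
open import Data.Nat.Properties hiding (_≟_)
open import Data.Nat using (ℕ; zero; suc; pred; _+_; _*_; _≤_; _<_; _<ᵇ_; _≤?_; _<?_; z≤n; s≤s)
open import Data.Nat.Tactic.RingSolver using (solve-∀)
open import Data.Nat.Combinatorics using (_C_; nC1≡n; nCk+nC[k+1]≡[n+1]C[k+1])
open import Data.Fin using (Fin; zero; suc; toℕ; _≟_)
open import Data.Fin.Properties
  using (any?; ¬∀⟶∃¬; injective⇒≤; toℕ-injective; punchIn-injective; punchInᵢ≢i; punchIn-punchOut)
open import Data.List
  using (List; []; _∷_; _++_; foldr; map; length; lookup; concatMap; cartesianProductWith)
open import Data.List.Base using (allFin; tabulate)
open import Data.List.Properties using (map-tabulate; length-map; length-++)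
import Data.Nat.ListAction as ListAction
open import Algebra.Properties.Semiring.Sum +-*-semiring
  using (sum-syntax; sum-cong-≗; ∑-distrib-+; ∑-comm; *-distribˡ-sum; *-distribʳ-sum)
open import Data.List.Membership.Propositional using (_∈_; _∉_)
import Data.List.Membership.DecPropositional as DecMembership
open import Data.List.Membership.Propositional.Properties
  using (∈-allFin; ∈-map⁺; ∈-map⁻; ∈-++⁺ˡ; ∈-++⁺ʳ; ∈-concatMap⁺; ∈-cartesianProductWith⁺)
import Data.List.Relation.Unary.Any as Any
open import Data.List.Relation.Unary.Any.Properties using (lookup-index)
open import Data.List.Relation.Unary.Any using (here; there)
open import Data.Product using (∃; _×_; _,_; proj₁; proj₂)
open import Data.Sum using (_⊎_; inj₁; inj₂)
open import Relation.Binary.PropositionalEquality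
  using (_≡_; _≢_; refl; sym; trans; cong; cong₂; subst; module ≡-Reasoning)
open import Data.Empty using (⊥)
open import Relation.Nullary using (¬_; Dec; does; yes; no; contradiction)
open import Relation.Nullary.Decidable using (dec-true; dec-false)
open import Function using (_∘_; mk⇔)

∨-introˡ : ∀ {a b} → a ≡ true → a ∨ b ≡ true
∨-introˡ refl = refl

∨-introʳ : ∀ {a b} → b ≡ true → a ∨ b ≡ true
∨-introʳ {true}  _ = refl
∨-introʳ {false} e = e

∨-elim : ∀ {a b} → a ∨ b ≡ true → a ≡ true ⊎ b ≡ true
∨-elim {true}  _ = inj₁ refl
∨-elim {false} e = inj₂ e

∧-intro : ∀ {a b} → a ≡ true → b ≡ true → a ∧ b ≡ true
∧-intro refl refl = refl

∧-elim : ∀ {a b} → a ∧ b ≡ true → a ≡ true × b ≡ true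
∧-elim {true}  e = refl , e
∧-elim {false} ()

does-≟⇒≡ : ∀ {n} (u w : Fin n) → does (u ≟ w) ≡ true → u ≡ w
does-≟⇒≡ u w with u ≟ w
... | yes u≡w = λ _ → u≡w
... | no  _   = λ ()

module _ {A : Set} (p : A → Bool) where

  private
    anyL : List A → Bool
    anyL = foldr (λ x b → p x ∨ b) false

  anyL-intro : ∀ {x} xs → x ∈ xs → p x ≡ true → anyL xs ≡ true
  anyL-intro (_ ∷ _)  (here refl) px = ∨-introˡ px
  anyL-intro (_ ∷ xs) (there x∈xs) px = ∨-introʳ (anyL-intro xs x∈xs px)

  anyL-elim : ∀ xs → anyL xs ≡ true → ∃ λ x → p x ≡ true
  anyL-elim (y ∷ xs) e with ∨-elim {p y} e
  ... | inj₁ py = y , py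
  ... | inj₂ e′ = anyL-elim xs e′

anyV-intro : ∀ {n} (p : Fin n → Bool) {x} → p x ≡ true → anyV p ≡ true
anyV-intro {n} p {x} = anyL-intro p (allFin n) (∈-allFin x)

anyV-elim : ∀ {n} (p : Fin n → Bool) → anyV p ≡ true → ∃ λ x → p x ≡ true
anyV-elim {n} p = anyL-elim p (allFin n)

-- A wrapper with rigid indices, so that graph, length and endpoints are inferred by unification.
record Reaches {n} (G : Graph n) (k : ℕ) (u w : Fin n) : Set where
  constructor reaches
  field reach≡true : reach G k u w ≡ true
open Reaches public

module _ {n} {G : Graph n} where

  reaches-zero⇒≡ : ∀ {u w} → Reaches G 0 u w → u ≡ w
  reaches-zero⇒≡ {u} {w} (reaches e) = does-≟⇒≡ u w e

  reaches-refl : ∀ {u} → Reaches G 0 u u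
  reaches-refl {u} = reaches (dec-true (u ≟ u) refl)

  reaches-suc : ∀ {k u w} → Reaches G k u w → Reaches G (suc k) u w
  reaches-suc (reaches e) = reaches (∨-introˡ e)

  reaches-snoc : ∀ {k u w x} → Reaches G k u w → adj G w x ≡ true → Reaches G (suc k) u x
  reaches-snoc {k} {u} {x = x} (reaches e) wx =
    reaches (∨-introʳ (anyV-intro (λ z → reach G k u z ∧ adj G z x) (∧-intro e wx)))

  reaches-suc⁻ : ∀ {k u x} → Reaches G (suc k) u x →
                 Reaches G k u x ⊎ ∃ λ w → Reaches G k u w × adj G w x ≡ true
  reaches-suc⁻ {k} {u} {x} (reaches e) with ∨-elim {reach G k u x} e
  ... | inj₁ ux = inj₁ (reaches ux)
  ... | inj₂ e′ with anyV-elim (λ z → reach G k u z ∧ adj G z x) e′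
  ... | w , uwx with ∧-elim uwx
  ... | uw , wx = inj₂ (w , reaches uw , wx)

  reaches-mono : ∀ {j k u w} → j ≤ k → Reaches G j u w → Reaches G k u w
  reaches-mono {k = zero}  z≤n   uw = uw
  reaches-mono {k = suc k} j≤1+k uw with m≤n⇒m<n∨m≡n j≤1+k
  ... | inj₁ (s≤s j≤k) = reaches-suc (reaches-mono j≤k uw)
  ... | inj₂ refl      = uw

  reaches-cons : ∀ {k u x w} → adj G u x ≡ true → Reaches G k x w → Reaches G (suc k) u w
  reaches-cons {zero} ux xw with reaches-zero⇒≡ xw
  ... | refl = reaches-snoc reaches-refl ux
  reaches-cons {suc k} ux xw with reaches-suc⁻ xw
  ... | inj₁ xw′           = reaches-suc (reaches-cons ux xw′)
  ... | inj₂ (z , xz , zw) = reaches-snoc (reaches-cons ux xz) zw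

  reaches-sym : ∀ {k u w} → Reaches G k u w → Reaches G k w u
  reaches-sym {zero} uw with reaches-zero⇒≡ uw
  ... | refl = uw
  reaches-sym {suc k} uw with reaches-suc⁻ uw
  ... | inj₁ uw′           = reaches-suc (reaches-sym uw′)
  ... | inj₂ (z , uz , zw) = reaches-cons (trans (Graph.sym G _ _) zw) (reaches-sym uz)

  reaches-trans : ∀ {i j u w x} → Reaches G i u w → Reaches G j w x → Reaches G (i + j) u x
  reaches-trans {i} uw wx = reaches-mono (≤-reflexive (+-comm _ i)) (go uw wx)
    where
      go : ∀ {i j u w x} → Reaches G i u w → Reaches G j w x → Reaches G (j + i) u x
      go {j = zero} uw wx with reaches-zero⇒≡ wx
      ... | refl = uw
      go {j = suc j} uw wx with reaches-suc⁻ wx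
      ... | inj₁ wx′           = reaches-suc (go uw wx′)
      ... | inj₂ (z , wz , zx) = reaches-snoc (go uw wz) zx

  reaches-one⁻ : ∀ {u w} → Reaches G 1 u w → u ≡ w ⊎ adj G u w ≡ true
  reaches-one⁻ uw with reaches-suc⁻ uw
  ... | inj₁ uw′ = inj₁ (reaches-zero⇒≡ uw′)
  ... | inj₂ (z , uz , zw) with reaches-zero⇒≡ uz
  ... | refl = inj₂ zw

  reaches-last : ∀ {j u w} → Reaches G (suc j) u w → u ≢ w →
                 ∃ λ p → Reaches G j u p × adj G p w ≡ true
  reaches-last {j} uw u≢w with reaches-suc⁻ uw
  ... | inj₂ step = step
  reaches-last {zero}  uw u≢w | inj₁ uw′ = contradiction (reaches-zero⇒≡ uw′) u≢w
  reaches-last {suc j} uw u≢w | inj₁ uw′ with reaches-last uw′ u≢w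
  ... | p , up , pw = p , reaches-suc up , pw

search : (ℕ → Bool) → (fuel start : ℕ) → ℕ
search f zero       k = k
search f (suc fuel) k = if f k then k else search f fuel (suc k)

searchDist≡search : ∀ {n} (G : Graph n) u w fuel k →
                    searchDist G u w fuel k ≡ search (λ j → reach G j u w) fuel k
searchDist≡search G u w zero       k = refl
searchDist≡search G u w (suc fuel) k with reach G k u w
... | true  = refl
... | false = searchDist≡search G u w fuel (suc k)

module _ (f : ℕ → Bool) where

  search-cong : ∀ {g} → (∀ j → f j ≡ g j) → ∀ fuel k → search f fuel k ≡ search g fuel k
  search-cong f≗g zero       k = refl
  search-cong {g} f≗g (suc fuel) k rewrite f≗g k with g k
  ... | true  = refl
  ... | false = search-cong f≗g fuel (suc k)

  search-≤ : ∀ fuel {k j} → k ≤ j → f j ≡ true → search f fuel k ≤ j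
  search-≤ zero       k≤j fj = k≤j
  search-≤ (suc fuel) {k} k≤j fj with f k in fk
  ... | true  = k≤j
  ... | false with m≤n⇒m<n∨m≡n k≤j
  ... | inj₁ k<j  = search-≤ fuel k<j fj
  ... | inj₂ refl = contradiction fk (not-¬ fj)

  search-found : ∀ fuel k → search f fuel k < k + fuel → f (search f fuel k) ≡ true
  search-found zero       k s<k = contradiction s<k (<-irrefl (sym (+-identityʳ k)))
  search-found (suc fuel) k s<k with f k in fk
  ... | true  = fk
  ... | false = search-found fuel (suc k) (subst (search f fuel (suc k) <_) (+-suc k fuel) s<k)

  search-≥ : ∀ fuel {k m} → (∀ i → k ≤ i → i < m → f i ≡ false) → m ≤ k + fuel → m ≤ search f fuel k
  search-≥ zero       {k} {m} _ m≤k = subst (m ≤_) (+-identityʳ k) m≤k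
  search-≥ (suc fuel) {k} {m} below m≤ with f k in fk
  ... | false = search-≥ fuel (λ i k<i → below i (<⇒≤ k<i)) (subst (m ≤_) (+-suc k fuel) m≤)
  ... | true with m ≤? k
  ... | yes m≤k = m≤k
  ... | no  m≰k = contradiction fk (not-¬ (below k ≤-refl (≰⇒> m≰k)))

  search-suc-fuel : ∀ fuel k → search f fuel k < k + fuel → search f (suc fuel) k ≡ search f fuel k
  search-suc-fuel zero       k s<k = contradiction s<k (<-irrefl (sym (+-identityʳ k)))
  search-suc-fuel (suc fuel) k s<k with f k
  ... | true  = refl
  ... | false = search-suc-fuel fuel (suc k) (subst (search f fuel (suc k) <_) (+-suc k fuel) s<k)

distinct⇒2≤ : ∀ {n} {u w : Fin n} → u ≢ w → 2 ≤ n
distinct⇒2≤ {suc zero}    {zero} {zero} u≢w = contradiction refl u≢w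
distinct⇒2≤ {suc (suc _)} _ = s≤s (s≤s z≤n)

module _ {n} {G : Graph n} where

  dist-≤ : ∀ {j u w} → Reaches G j u w → dist G u w ≤ j
  dist-≤ {j} {u} {w} (reaches e) rewrite searchDist≡search G u w n 0 = search-≤ _ n z≤n e

  dist-reaches : ∀ {u w} → dist G u w < n → Reaches G (dist G u w) u w
  dist-reaches {u} {w} d<n rewrite searchDist≡search G u w n 0 = reaches (search-found _ n 0 d<n)

  dist-≥ : ∀ {m u w} → (∀ {i} → i < m → ¬ Reaches G i u w) → m ≤ n → m ≤ dist G u w
  dist-≥ {m} {u} {w} unreachable m≤n rewrite searchDist≡search G u w n 0 =
    search-≥ _ n (λ i _ i<m → ¬-not (λ e → unreachable i<m (reaches e))) m≤n

  dist≥1 : ∀ {u w} → u ≢ w → 1 ≤ dist G u w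
  dist≥1 u≢w = dist-≥ unreachable (≤-trans (s≤s z≤n) (distinct⇒2≤ u≢w))
    where
      unreachable : ∀ {i} → i < 1 → ¬ Reaches G i _ _
      unreachable (s≤s z≤n) uw = u≢w (reaches-zero⇒≡ uw)

  dist≥2 : ∀ {u w} → u ≢ w → adj G u w ≡ false → 2 ≤ dist G u w
  dist≥2 u≢w ¬uw = dist-≥ unreachable (distinct⇒2≤ u≢w)
    where
      unreachable : ∀ {i} → i < 2 → ¬ Reaches G i _ _
      unreachable i<2 uw with reaches-one⁻ (reaches-mono (≤-pred i<2) uw)
      ... | inj₁ u≡w = u≢w u≡w
      ... | inj₂ adj≡true = not-¬ adj≡true ¬uw

maxList-ub : ∀ {x xs} → x ∈ xs → x ≤ maxList xs
maxList-ub (here refl)  = m≤m⊔n _ _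
maxList-ub (there x∈xs) = ≤-trans (maxList-ub x∈xs) (m≤n⊔m _ _)

maxList-lub : ∀ {b} xs → (∀ {x} → x ∈ xs → x ≤ b) → maxList xs ≤ b
maxList-lub []       _  = z≤n
maxList-lub (x ∷ xs) ub = ⊔-lub (ub (here refl)) (maxList-lub xs (λ x∈xs → ub (there x∈xs)))

maxList-∈ : ∀ x xs → maxList (x ∷ xs) ∈ x ∷ xs
maxList-∈ x []       = here (⊔-identityʳ x)
maxList-∈ x (y ∷ xs) with ⊔-sel x (maxList (y ∷ xs))
... | inj₁ e = here e
... | inj₂ e = there (subst (_∈ y ∷ xs) (sym e) (maxList-∈ y xs))

minList-lb : ∀ {x y ys} → x ∈ y ∷ ys → minList (y ∷ ys) ≤ x
minList-lb {ys = []}     (here refl)         = ≤-refl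
minList-lb {ys = z ∷ ys} (here refl)         = ≤-trans (m⊓n≤n z _) (minList-lb {ys = ys} (here refl))
minList-lb {ys = z ∷ ys} (there (here refl)) = m⊓n≤m z _
minList-lb {ys = z ∷ ys} (there (there x∈)) = ≤-trans (m⊓n≤n z _) (minList-lb {ys = ys} (there x∈))

minList-glb : ∀ {b} y ys → (∀ {x} → x ∈ y ∷ ys → b ≤ x) → b ≤ minList (y ∷ ys)
minList-glb y []       lb = lb (here refl)
minList-glb y (z ∷ ys) lb = ⊓-glb (lb (there (here refl))) (minList-glb y ys lb′)
  where
    lb′ : ∀ {x} → x ∈ y ∷ ys → _ ≤ x
    lb′ (here e)   = lb (here e)
    lb′ (there x∈) = lb (there (there x∈))

minList-∈ : ∀ y ys → minList (y ∷ ys) ∈ y ∷ ys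
minList-∈ y []       = here refl
minList-∈ y (z ∷ ys) with ⊓-sel z (minList (y ∷ ys))
... | inj₁ e = there (here e)
... | inj₂ e with minList-∈ y ys
...   | here  e′ = here (trans e e′)
...   | there m∈ = there (there (subst (_∈ ys) (sym e) m∈))

module _ {n} (G : Graph n) where

  dist≤ecc : ∀ u w → dist G u w ≤ ecc G u
  dist≤ecc u w = maxList-ub (∈-map⁺ (dist G u) (∈-allFin w))

  ecc≤ : ∀ {u b} → (∀ w → dist G u w ≤ b) → ecc G u ≤ b
  ecc≤ {u} {b} ub = maxList-lub (map (dist G u) (allFin n)) λ d∈ →
    let w , _ , d≡ = ∈-map⁻ (dist G u) d∈ in subst (_≤ b) (sym d≡) (ub w)

module _ {n} (G : Graph (suc n)) where

  farthest : ∀ u → ∃ λ w → ecc G u ≡ dist G u w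
  farthest u with ∈-map⁻ (dist G u) {xs = allFin (suc n)}
                      (maxList-∈ (dist G u zero) (map (dist G u) (tabulate suc)))
  ... | w , _ , e = w , e

  radius≤ecc : ∀ u → radius G ≤ ecc G u
  radius≤ecc u = minList-lb (∈-map⁺ (ecc G) (∈-allFin u))

  ≤radius : ∀ {b} → (∀ u → b ≤ ecc G u) → b ≤ radius G
  ≤radius {b} lb = minList-glb (ecc G zero) (map (ecc G) (tabulate suc)) λ e∈ →
    let u , _ , e≡ = ∈-map⁻ (ecc G) {xs = allFin (suc n)} e∈ in subst (b ≤_) (sym e≡) (lb u)

  centre : ∃ λ c → radius G ≡ ecc G c
  centre with ∈-map⁻ (ecc G) {xs = allFin (suc n)} (minList-∈ (ecc G zero) (map (ecc G) (tabulate suc)))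
  ... | c , _ , e = c , e

module Deletion {m} (G : Graph (suc m)) (v : Fin (suc m)) where

  data Deleted? : Fin (suc m) → Set where
    deleted : Deleted? v
    kept    : ∀ x → Deleted? (skip v x)

  deleted? : ∀ w → Deleted? w
  deleted? w with w ≟ v
  ... | yes refl = deleted
  ... | no  w≢v  = subst Deleted? (punchIn-punchOut (w≢v ∘ sym)) (kept _)

  Detourable : Set
  Detourable = ∀ p y → adj G (skip v p) v ≡ true → adj G v (skip v y) ≡ true →
               adj G (skip v p) (skip v y) ≡ false →
               ∃ λ w → adj G (skip v p) (skip v w) ≡ true × adj G (skip v w) (skip v y) ≡ true

  reaches-─⁺ : ∀ {k x y} → Reaches (G ─ v) k x y → Reaches G k (skip v x) (skip v y)
  reaches-─⁺ {zero} xy with reaches-zero⇒≡ xy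
  ... | refl = reaches-refl
  reaches-─⁺ {suc k} xy with reaches-suc⁻ xy
  ... | inj₁ xy′           = reaches-suc (reaches-─⁺ xy′)
  ... | inj₂ (z , xz , zy) = reaches-snoc (reaches-─⁺ xz) zy

  module _ (detour : Detourable) where

    reroute : ∀ {j x p y} → Reaches (G ─ v) j x p →
              adj G (skip v p) v ≡ true → adj G v (skip v y) ≡ true → Reaches (G ─ v) (2 + j) x y
    reroute {p = p} {y} xp pv vy with adj G (skip v p) (skip v y) in py
    ... | true  = reaches-suc (reaches-snoc xp py)
    ... | false with detour p y pv vy py
    ...   | w , pw , wy = reaches-snoc (reaches-snoc xp pw) wy

    reaches-─⁻ : ∀ {k x y} → Reaches G k (skip v x) (skip v y) → Reaches (G ─ v) k x y
    reaches-─⁻ {zero} xy =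
      subst (Reaches (G ─ v) 0 _) (punchIn-injective v _ _ (reaches-zero⇒≡ xy)) reaches-refl
    reaches-─⁻ {suc k} {x} xy with reaches-suc⁻ xy
    ... | inj₁ xy′ = reaches-suc (reaches-─⁻ xy′)
    ... | inj₂ (w , xw , wy) with deleted? w
    ...   | kept w′ = reaches-snoc (reaches-─⁻ xw) wy
    ...   | deleted with k
    ...     | zero  = contradiction (reaches-zero⇒≡ xw) (punchInᵢ≢i v x)
    ...     | suc j with reaches-last xw (punchInᵢ≢i v x)
    ...       | p , xp , pv with deleted? p
    ...         | deleted = contradiction pv (not-¬ (irrefl G v))
    ...         | kept p′ = reroute (reaches-─⁻ xp) pv wy

    reach-─≡ : ∀ k x y → reach (G ─ v) k x y ≡ reach G k (skip v x) (skip v y)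
    reach-─≡ k x y =
      ⇔→≡ {z = true} (mk⇔ (λ e → reach≡true (reaches-─⁺ {k} {x} {y} (reaches e)))
                           (λ e → reach≡true (reaches-─⁻ {k} {x} {y} (reaches e))))

    connected-─ : Connected G → Connected (G ─ v)
    connected-─ conn x y with conn (skip v x) (skip v y)
    ... | k , xy = k , trans (reach-─≡ k x y) xy

    -- dist (G ─ v) searches with one unit of fuel less than dist G; b < m makes that unit irrelevant.
    dist-─ : ∀ {b x y} → b < m → Reaches G b (skip v x) (skip v y) →
             dist (G ─ v) x y ≡ dist G (skip v x) (skip v y)
    dist-─ {b} {x} {y} b<m xy = begin
        dist (G ─ v) x y
      ≡⟨ searchDist≡search (G ─ v) x y m 0 ⟩
        search (λ j → reach (G ─ v) j x y) m 0
      ≡⟨ search-cong _ (λ j → reach-─≡ j x y) m 0 ⟩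
        search f m 0
      ≡⟨ sym (search-suc-fuel f m 0 (≤-<-trans (search-≤ f m z≤n (reach≡true xy)) b<m)) ⟩
        search f (suc m) 0
      ≡⟨ sym (searchDist≡search G (skip v x) (skip v y) (suc m) 0) ⟩
        dist G (skip v x) (skip v y) ∎
      where
        open ≡-Reasoning
        f : ℕ → Bool
        f j = reach G j (skip v x) (skip v y)

  ecc-─ : (∀ x y → dist (G ─ v) x y ≡ dist G (skip v x) (skip v y)) →
          (∀ x → ∃ λ y → dist G (skip v x) v ≤ dist G (skip v x) (skip v y)) →
          ∀ x → ecc (G ─ v) x ≡ ecc G (skip v x)
  ecc-─ dist≡ rival x = ≤-antisym
    (ecc≤ (G ─ v) λ y → subst (_≤ ecc G (skip v x)) (sym (dist≡ x y)) (dist≤ecc G _ _))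
    (ecc≤ G bound)
    where
      via-kept : ∀ y → dist G (skip v x) (skip v y) ≤ ecc (G ─ v) x
      via-kept y = subst (_≤ ecc (G ─ v) x) (dist≡ x y) (dist≤ecc (G ─ v) x y)
      bound : ∀ w → dist G (skip v x) w ≤ ecc (G ─ v) x
      bound w with deleted? w
      ... | kept y  = via-kept y
      ... | deleted = let y , v≤y = rival x in ≤-trans v≤y (via-kept y)

radius-─ : ∀ {m} (G : Graph (suc (suc m))) {v c} → c ≢ v → radius G ≡ ecc G c →
           (∀ x → ecc (G ─ v) x ≡ ecc G (skip v x)) → radius (G ─ v) ≡ radius G
radius-─ G {v} {c} c≢v rad≡ ecc≡ =
  ≤-antisym at-centre
    (≤radius (G ─ v) λ x → subst (radius G ≤_) (sym (ecc≡ x)) (radius≤ecc G (skip v x)))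
  where
    open Deletion G v using (Deleted?; deleted?; deleted; kept)
    at-centre : radius (G ─ v) ≤ radius G
    at-centre with deleted? c
    ... | deleted = contradiction refl c≢v
    ... | kept c′ = ≤-trans (radius≤ecc (G ─ v) c′) (≤-reflexive (trans (ecc≡ c′) (sym rad≡)))

𝟙 : Bool → ℕ
𝟙 true  = 1
𝟙 false = 0

1+nonAdjacent≤dist : ∀ {n} {G : Graph n} {u w} → u ≢ w → 1 + 𝟙 (not (adj G u w)) ≤ dist G u w
1+nonAdjacent≤dist {G = G} {u} {w} u≢w with adj G u w in uw
... | true  = dist≥1 u≢w
... | false = dist≥2 u≢w uw

∑-mono-≤ : ∀ {n} {f g : Fin n → ℕ} → (∀ i → f i ≤ g i) → ∑[ i < n ] f i ≤ ∑[ i < n ] g i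
∑-mono-≤ {zero}  f≤g = z≤n
∑-mono-≤ {suc n} f≤g = +-mono-≤ (f≤g zero) (∑-mono-≤ (f≤g ∘ suc))

∑-const : ∀ n c → ∑[ i < n ] c ≡ n * c
∑-const zero    c = refl
∑-const (suc n) c = cong (c +_) (∑-const n c)

∑-δ : ∀ {n} (x : Fin n) → ∑[ w < n ] 𝟙 (does (w ≟ x)) ≡ 1
∑-δ {suc n} zero    = cong suc (trans (∑-const n 0) (*-zeroʳ n))
∑-δ {suc n} (suc x) = ∑-δ x

sum-map-allFin : ∀ {n} (f : Fin n → ℕ) → ListAction.sum (map f (allFin n)) ≡ ∑[ i < n ] f i
sum-map-allFin {n} f = trans (cong ListAction.sum (map-tabulate (λ i → i) f)) (sum-tabulate f)
  where
    sum-tabulate : ∀ {n} (f : Fin n → ℕ) → ListAction.sum (tabulate f) ≡ ∑[ i < n ] f i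
    sum-tabulate {zero}  f = refl
    sum-tabulate {suc n} f = cong (f zero +_) (sum-tabulate (f ∘ suc))

∑-pairs : ∀ n → ∑[ u < n ] ∑[ w < n ] 𝟙 (toℕ u <ᵇ toℕ w) ≡ n C 2
∑-pairs zero    = refl
∑-pairs (suc m) = begin
    ∑[ w < m ] 1 + ∑[ u < m ] ∑[ w < m ] 𝟙 (toℕ u <ᵇ toℕ w)
  ≡⟨ cong₂ _+_ (∑-const m 1) (∑-pairs m) ⟩
    m * 1 + m C 2
  ≡⟨ cong (_+ m C 2) (trans (*-identityʳ m) (sym (nC1≡n m))) ⟩
    m C 1 + m C 2
  ≡⟨ nCk+nC[k+1]≡[n+1]C[k+1] m 1 ⟩
    suc m C 2 ∎
  where open ≡-Reasoning

<ᵇ-irrefl : ∀ n → (n <ᵇ n) ≡ false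
<ᵇ-irrefl zero    = refl
<ᵇ-irrefl (suc n) = <ᵇ-irrefl n

<ᵇ-trichotomy : ∀ m n → m ≡ n ⊎ (m <ᵇ n) ≡ true  × (n <ᵇ m) ≡ false
                      ⊎ (m <ᵇ n) ≡ false × (n <ᵇ m) ≡ true
<ᵇ-trichotomy zero    zero    = inj₁ refl
<ᵇ-trichotomy zero    (suc n) = inj₂ (inj₁ (refl , refl))
<ᵇ-trichotomy (suc m) zero    = inj₂ (inj₂ (refl , refl))
<ᵇ-trichotomy (suc m) (suc n) with <ᵇ-trichotomy m n
... | inj₁ m≡n = inj₁ (cong suc m≡n)
... | inj₂ m≶n = inj₂ m≶n

<ᵇ⇒≢ : ∀ {n} {u w : Fin n} → (toℕ u <ᵇ toℕ w) ≡ true → u ≢ w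
<ᵇ⇒≢ {u = u} u<w refl = not-¬ u<w (<ᵇ-irrefl (toℕ u))

select : ∀ {n} → (Fin n → Bool) → List (Fin n)
select {zero}  p = []
select {suc n} p with p zero
... | true  = zero ∷ map suc (select (p ∘ suc))
... | false = map suc (select (p ∘ suc))

∈-select : ∀ {n} (p : Fin n → Bool) {x} → p x ≡ true → x ∈ select p
∈-select {suc n} p {zero}  px rewrite px = here refl
∈-select {suc n} p {suc x} px with p zero
... | true  = there (∈-map⁺ suc (∈-select (p ∘ suc) px))
... | false = ∈-map⁺ suc (∈-select (p ∘ suc) px)

length-select : ∀ {n} (p : Fin n → Bool) → length (select p) ≡ ∑[ i < n ] 𝟙 (p i)
length-select {zero}  p = refl
length-select {suc n} p with p zero
... | true  = cong suc (trans (length-map suc (select (p ∘ suc))) (length-select (p ∘ suc)))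
... | false = trans (length-map suc (select (p ∘ suc))) (length-select (p ∘ suc))

length-concatMap-≤ : ∀ {A B : Set} (f : A → List B) {c} → (∀ x → length (f x) ≤ c) →
                     ∀ xs → length (concatMap f xs) ≤ length xs * c
length-concatMap-≤ f short []       = z≤n
length-concatMap-≤ f short (x ∷ xs) =
  subst (_≤ _) (sym (length-++ (f x))) (+-mono-≤ (short x) (length-concatMap-≤ f short xs))

length-cartesianProductWith : ∀ {A B C : Set} (f : A → B → C) xs ys →
                              length (cartesianProductWith f xs ys) ≡ length xs * length ys
length-cartesianProductWith f []       ys = refl
length-cartesianProductWith f (x ∷ xs) ys = begin
    length (map (f x) ys ++ cartesianProductWith f xs ys)
  ≡⟨ length-++ (map (f x) ys) ⟩
    length (map (f x) ys) + length (cartesianProductWith f xs ys)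
  ≡⟨ cong₂ _+_ (length-map (f x) ys) (length-cartesianProductWith f xs ys) ⟩
    length ys + length xs * length ys ∎
  where open ≡-Reasoning

module Degrees {n} (G : Graph n) where

  nonNeighbour : Fin n → Fin n → Bool
  nonNeighbour x w = not (does (w ≟ x)) ∧ not (adj G x w)

  deg codeg : Fin n → ℕ
  deg   x = ∑[ w < n ] 𝟙 (adj G x w)
  codeg x = ∑[ w < n ] 𝟙 (nonNeighbour x w)

  deg+codeg : ∀ x → deg x + codeg x + 1 ≡ n
  deg+codeg x = begin
      deg x + codeg x + 1
    ≡⟨ cong₂ _+_ (sym (∑-distrib-+ adjacent (𝟙 ∘ nonNeighbour x))) (sym (∑-δ x)) ⟩
      ∑[ w < n ] (adjacent w + 𝟙 (nonNeighbour x w)) + ∑[ w < n ] equal w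
    ≡⟨ sym (∑-distrib-+ (λ w → adjacent w + 𝟙 (nonNeighbour x w)) equal) ⟩
      ∑[ w < n ] (adjacent w + 𝟙 (nonNeighbour x w) + equal w)
    ≡⟨ sum-cong-≗ partition ⟩
      ∑[ w < n ] 1
    ≡⟨ trans (∑-const n 1) (*-identityʳ n) ⟩
      n ∎
    where
      open ≡-Reasoning
      adjacent equal : Fin n → ℕ
      adjacent w = 𝟙 (adj G x w)
      equal    w = 𝟙 (does (w ≟ x))
      partition : ∀ w → adjacent w + 𝟙 (nonNeighbour x w) + equal w ≡ 1
      partition w with w ≟ x
      ... | yes refl rewrite irrefl G x = refl
      ... | no  _    with adj G x w
      ...   | true  = refl
      ...   | false = refl

  nonNeighbour-intro : ∀ {y w} → w ≢ y → adj G y w ≡ false → nonNeighbour y w ≡ true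
  nonNeighbour-intro {y} {w} w≢y yw rewrite dec-false (w ≟ y) w≢y | yw = refl

  deg≤codeg : ∀ {x y} → (∀ w → adj G x w ≡ true → nonNeighbour y w ≡ true) → deg x ≤ codeg y
  deg≤codeg {x} {y} ⊆nonNeighbours = ∑-mono-≤ pointwise
    where
      pointwise : ∀ w → 𝟙 (adj G x w) ≤ 𝟙 (nonNeighbour y w)
      pointwise w with adj G x w in xw
      ... | false = z≤n
      ... | true  = ≤-reflexive (cong 𝟙 (sym (⊆nonNeighbours w xw)))

  deg≤codeg+1 : ∀ {x y} v → (∀ w → adj G x w ≡ true → w ≢ v → nonNeighbour y w ≡ true) →
                deg x ≤ codeg y + 1
  deg≤codeg+1 {x} {y} v ⊆nonNeighbours = begin
      deg x
    ≤⟨ ∑-mono-≤ pointwise ⟩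
      ∑[ w < n ] (𝟙 (nonNeighbour y w) + 𝟙 (does (w ≟ v)))
    ≡⟨ ∑-distrib-+ (𝟙 ∘ nonNeighbour y) (λ w → 𝟙 (does (w ≟ v))) ⟩
      codeg y + ∑[ w < n ] 𝟙 (does (w ≟ v))
    ≡⟨ cong (codeg y +_) (∑-δ v) ⟩
      codeg y + 1 ∎
    where
      open ≤-Reasoning
      pointwise : ∀ w → 𝟙 (adj G x w) ≤ 𝟙 (nonNeighbour y w) + 𝟙 (does (w ≟ v))
      pointwise w with adj G x w in xw | w ≟ v
      ... | false | _        = z≤n
      ... | true  | yes _    = m≤n+m 1 _
      ... | true  | no  w≢v rewrite ⊆nonNeighbours w xw w≢v = s≤s z≤n

  unique-common-neighbour⇒deg≤codeg+1 : ∀ {p v y} → adj G p y ≡ false →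
    (∀ w → adj G p w ≡ true → adj G w y ≡ true → w ≡ v) → deg p ≤ codeg y + 1
  unique-common-neighbour⇒deg≤codeg+1 {p} {v} {y} ¬py unique = deg≤codeg+1 v λ w pw w≢v →
    nonNeighbour-intro (λ { refl → not-¬ pw ¬py })
                       (¬-not λ yw → w≢v (unique w pw (trans (Graph.sym G w y) yw)))

  distant⇒deg≤codeg : ∀ {u v} → 3 ≤ dist G u v → deg v ≤ codeg u
  distant⇒deg≤codeg {u} {v} 3≤d = deg≤codeg λ w vw →
    nonNeighbour-intro
      (λ { refl → too-close (reaches-snoc reaches-refl (trans (Graph.sym G u v) vw)) (s≤s (s≤s z≤n)) })
      (¬-not λ uw → too-close (reaches-snoc (reaches-snoc reaches-refl uw) (trans (Graph.sym G w v) vw)) ≤-refl)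
    where
      too-close : ∀ {j} → Reaches G j u v → j < 3 → ⊥
      too-close uv j<3 = <-irrefl refl (<-≤-trans (≤-<-trans (dist-≤ uv) j<3) 3≤d)

  nonEdge : Fin n → Fin n → ℕ
  nonEdge u w = 𝟙 ((toℕ u <ᵇ toℕ w) ∧ not (adj G u w))

  nonEdges : ℕ
  nonEdges = ∑[ u < n ] ∑[ w < n ] nonEdge u w

  nonNeighbour-split : ∀ x w → 𝟙 (nonNeighbour x w) ≡ nonEdge x w + nonEdge w x
  nonNeighbour-split x w with <ᵇ-trichotomy (toℕ x) (toℕ w)
  ... | inj₁ x≡w with toℕ-injective x≡w
  ...   | refl rewrite dec-true (x ≟ x) refl | <ᵇ-irrefl (toℕ x) = refl
  nonNeighbour-split x w | inj₂ (inj₁ (x<w , w≮x))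
    rewrite dec-false (w ≟ x) (<ᵇ⇒≢ x<w ∘ sym) | x<w | w≮x =
      sym (+-identityʳ _)
  nonNeighbour-split x w | inj₂ (inj₂ (x≮w , w<x))
    rewrite dec-false (w ≟ x) (<ᵇ⇒≢ w<x) | x≮w | w<x | Graph.sym G x w =
      refl

  ∑codeg≡ : ∑[ x < n ] codeg x ≡ nonEdges + nonEdges
  ∑codeg≡ = begin
      ∑[ x < n ] codeg x
    ≡⟨ sum-cong-≗ (λ x → trans (sum-cong-≗ (nonNeighbour-split x))
                                (∑-distrib-+ (nonEdge x) (λ w → nonEdge w x))) ⟩
      ∑[ x < n ] (∑[ w < n ] nonEdge x w + ∑[ w < n ] nonEdge w x)
    ≡⟨ ∑-distrib-+ (λ x → ∑[ w < n ] nonEdge x w) (λ x → ∑[ w < n ] nonEdge w x) ⟩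
      nonEdges + ∑[ x < n ] ∑[ w < n ] nonEdge w x
    ≡⟨ cong (nonEdges +_) (∑-comm (λ x w → nonEdge w x)) ⟩
      nonEdges + nonEdges ∎
    where open ≡-Reasoning

  C2+nonEdges≤wiener : n C 2 + nonEdges ≤ wiener G
  C2+nonEdges≤wiener = begin
      n C 2 + nonEdges
    ≡⟨ cong (_+ nonEdges) (sym (∑-pairs n)) ⟩
      ∑[ u < n ] ∑[ w < n ] before u w + nonEdges
    ≡⟨ sym (∑-distrib-+ (λ u → ∑[ w < n ] before u w) (λ u → ∑[ w < n ] nonEdge u w)) ⟩
      ∑[ u < n ] (∑[ w < n ] before u w + ∑[ w < n ] nonEdge u w)
    ≡⟨ sum-cong-≗ (λ u → sym (∑-distrib-+ (before u) (nonEdge u))) ⟩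
      ∑[ u < n ] ∑[ w < n ] (before u w + nonEdge u w)
    ≤⟨ ∑-mono-≤ (λ u → ∑-mono-≤ (term-≤ u)) ⟩
      ∑[ u < n ] ∑[ w < n ] term u w
    ≡⟨ sym (trans (sum-map-allFin (λ u → ListAction.sum (map (term u) (allFin n))))
                  (sum-cong-≗ (λ u → sum-map-allFin (term u)))) ⟩
      wiener G ∎
    where
      open ≤-Reasoning
      before term : Fin n → Fin n → ℕ
      before u w = 𝟙 (toℕ u <ᵇ toℕ w)
      term   u w = if toℕ u <ᵇ toℕ w then dist G u w else 0
      term-≤ : ∀ u w → before u w + nonEdge u w ≤ term u w
      term-≤ u w with toℕ u <ᵇ toℕ w in u<w
      ... | false = z≤n
      ... | true  = 1+nonAdjacent≤dist {G = G} (<ᵇ⇒≢ {u = u} {w} u<w)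

module Candidates {n} (G : Graph (suc n)) (K : ℕ) where

  open Degrees G

  Sparse : Fin (suc n) → Set
  Sparse x = deg x ≤ codeg x + 1

  sparse deficient : List (Fin (suc n))
  sparse    = select (λ x → does (deg x ≤? codeg x + 1))
  deficient = select (λ x → does (K ≤? codeg x))

  smallNeighbourhood : Fin (suc n) → List (Fin (suc n))
  smallNeighbourhood x with deg x ≤? K
  ... | yes _ = select (adj G x)
  ... | no  _ = []

  commonNeighbour : Fin (suc n) → Fin (suc n) → Fin (suc n)
  commonNeighbour p y with any? (λ w → (adj G p w ∧ adj G w y) Bool.≟ true)
  ... | yes (w , _) = w
  ... | no  _       = p

  farthestFrom : Fin (suc n) → Fin (suc n)
  farthestFrom u = proj₁ (farthest G u)

  neighbourhoods farthests commonNeighbours₁ commonNeighbours₂ exceptional : List (Fin (suc n))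
  neighbourhoods    = concatMap smallNeighbourhood sparse
  farthests         = map farthestFrom deficient
  commonNeighbours₁ = cartesianProductWith commonNeighbour sparse deficient
  commonNeighbours₂ = cartesianProductWith commonNeighbour deficient sparse
  exceptional = sparse ++ neighbourhoods ++ farthests ++ commonNeighbours₁ ++ commonNeighbours₂

  ∈-sparse : ∀ {x} → Sparse x → x ∈ sparse
  ∈-sparse {x} = ∈-select (λ x → does (deg x ≤? codeg x + 1)) ∘ dec-true (deg x ≤? codeg x + 1)

  ∈-deficient : ∀ {x} → K ≤ codeg x → x ∈ deficient
  ∈-deficient {x} = ∈-select (λ x → does (K ≤? codeg x)) ∘ dec-true (K ≤? codeg x)

  commonNeighbour-unique : ∀ {p v y} → adj G p v ≡ true → adj G v y ≡ true →
                           (∀ w → adj G p w ≡ true → adj G w y ≡ true → w ≡ v) →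
                           commonNeighbour p y ≡ v
  commonNeighbour-unique {p} {v} {y} pv vy unique with any? (λ w → (adj G p w ∧ adj G w y) Bool.≟ true)
  ... | yes (w , pwy) = let pw , wy = ∧-elim pwy in unique w pw wy
  ... | no  none      = contradiction (v , ∧-intro pv vy) none

  farthestFrom-sole : ∀ {u v} → (∀ w → w ≢ v → dist G u w < dist G u v) → farthestFrom u ≡ v
  farthestFrom-sole {u} {v} sole with farthestFrom u ≟ v
  ... | yes far≡v = far≡v
  ... | no  far≢v = contradiction (sole _ far≢v)
                      (≤⇒≯ (subst (dist G u v ≤_) (proj₂ (farthest G u)) (dist≤ecc G u v)))

  ∈-smallNeighbourhood : ∀ {x w} → deg x ≤ K → adj G x w ≡ true → w ∈ smallNeighbourhood x
  ∈-smallNeighbourhood {x} low xw with deg x ≤? K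
  ... | yes _    = ∈-select (adj G x) xw
  ... | no  high = contradiction low high

  K<deg⇒K≤codeg : ∀ {x z} → ¬ deg x ≤ K → deg x ≤ codeg z + 1 → K ≤ codeg z
  K<deg⇒K≤codeg {z = z} high x≤z =
    ≤-pred (subst (suc K ≤_) (+-comm (codeg z) 1) (≤-trans (≰⇒> high) x≤z))

  module _ (K+K≤N : K + K ≤ suc n) where

    lowDegree⇒sparse : ∀ {x} → deg x ≤ K → Sparse x
    lowDegree⇒sparse {x} low = ≤-trans low (+-cancelˡ-≤ K K (codeg x + 1) (begin
        K + K                 ≤⟨ K+K≤N ⟩
        suc n                 ≡⟨ sym (deg+codeg x) ⟩
        deg x + codeg x + 1   ≤⟨ +-monoˡ-≤ 1 (+-monoˡ-≤ (codeg x) low) ⟩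
        K + codeg x + 1       ≡⟨ +-assoc K (codeg x) 1 ⟩
        K + (codeg x + 1)     ∎))
      where open ≤-Reasoning

    small-neighbourhood⇒exceptional : ∀ {x w} → deg x ≤ K → adj G x w ≡ true → w ∈ exceptional
    small-neighbourhood⇒exceptional {x} low xw =
      ∈-++⁺ʳ sparse (∈-++⁺ˡ (∈-concatMap⁺ smallNeighbourhood
        (Any.map (λ { refl → ∈-smallNeighbourhood low xw })
                 (∈-sparse (lowDegree⇒sparse low)))))

    mutually-deficient⇒exceptional :
      ∀ {p v y} → adj G p v ≡ true → adj G v y ≡ true → commonNeighbour p y ≡ v →
      deg p ≤ codeg y + 1 → deg y ≤ codeg p + 1 → v ∈ exceptional
    mutually-deficient⇒exceptional {p} {v} {y} pv vy chosen p≤y y≤p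
      with deg p ≤? K | deg y ≤? K
    ... | yes p-low  | _         = small-neighbourhood⇒exceptional p-low pv
    ... | no  _      | yes y-low = small-neighbourhood⇒exceptional y-low (trans (Graph.sym G y v) vy)
    ... | no  p-high | no y-high with deg p ≤? codeg p + 1 | deg y ≤? codeg y + 1
    ...   | yes p-sparse | _ =
      ∈-++⁺ʳ sparse (∈-++⁺ʳ neighbourhoods (∈-++⁺ʳ farthests (∈-++⁺ˡ
        (subst (_∈ _) chosen (∈-cartesianProductWith⁺ commonNeighbour
          (∈-sparse p-sparse) (∈-deficient (K<deg⇒K≤codeg p-high p≤y)))))))
    ...   | no  _ | yes y-sparse =
      ∈-++⁺ʳ sparse (∈-++⁺ʳ neighbourhoods (∈-++⁺ʳ farthests (∈-++⁺ʳ commonNeighbours₁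
        (subst (_∈ _) chosen (∈-cartesianProductWith⁺ commonNeighbour
          (∈-deficient (K<deg⇒K≤codeg y-high y≤p)) (∈-sparse y-sparse))))))
    ...   | no p-dense | no y-dense = contradiction (begin-strict
        codeg p + 1  <⟨ ≰⇒> p-dense ⟩
        deg p        ≤⟨ p≤y ⟩
        codeg y + 1  <⟨ ≰⇒> y-dense ⟩
        deg y        ≤⟨ y≤p ⟩
        codeg p + 1  ∎) (<-irrefl refl)
      where open ≤-Reasoning

    unique-common-neighbour⇒exceptional :
      ∀ {p v y} → adj G p v ≡ true → adj G v y ≡ true → adj G p y ≡ false →
      (∀ w → adj G p w ≡ true → adj G w y ≡ true → w ≡ v) → v ∈ exceptional
    unique-common-neighbour⇒exceptional {p} {v} {y} pv vy ¬py unique =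
      mutually-deficient⇒exceptional pv vy (commonNeighbour-unique pv vy unique)
        (unique-common-neighbour⇒deg≤codeg+1 ¬py unique)
        (unique-common-neighbour⇒deg≤codeg+1 (trans (Graph.sym G y p) ¬py) λ w yw wp →
          unique w (trans (Graph.sym G p w) wp) (trans (Graph.sym G w y) yw))

    sole-farthest⇒exceptional : ∀ {u v} → 3 ≤ ecc G u → (∀ w → w ≢ v → dist G u w < dist G u v) →
                                v ∈ exceptional
    sole-farthest⇒exceptional {u} {v} 3≤ecc sole with K ≤? codeg u
    ... | yes u-deficient =
      ∈-++⁺ʳ sparse (∈-++⁺ʳ neighbourhoods (∈-++⁺ˡ
        (subst (_∈ farthests) (farthestFrom-sole sole) (∈-map⁺ farthestFrom (∈-deficient u-deficient)))))
    ... | no  u-dense =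
      ∈-++⁺ˡ (∈-sparse (lowDegree⇒sparse (≤-trans (distant⇒deg≤codeg 3≤d) (<⇒≤ (≰⇒> u-dense)))))
      where
        3≤d : 3 ≤ dist G u v
        3≤d = ≤-trans 3≤ecc
                (≤-reflexive (trans (proj₂ (farthest G u)) (cong (dist G u) (farthestFrom-sole sole))))

  sparse⇒N≤2codeg+2 : ∀ {x} → Sparse x → suc n ≤ 2 * codeg x + 2
  sparse⇒N≤2codeg+2 {x} sp = begin
      suc n                    ≡⟨ sym (deg+codeg x) ⟩
      deg x + codeg x + 1      ≤⟨ +-monoˡ-≤ 1 (+-monoˡ-≤ (codeg x) sp) ⟩
      codeg x + 1 + codeg x + 1 ≡⟨ rearrange (codeg x) ⟩
      2 * codeg x + 2          ∎
    where
      open ≤-Reasoning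
      rearrange : ∀ c → c + 1 + c + 1 ≡ 2 * c + 2
      rearrange = solve-∀

  length-sparse*N : length sparse * suc n ≤ 2 * ∑[ x < suc n ] codeg x + suc n * 2
  length-sparse*N = begin
      length sparse * suc n
    ≡⟨ cong (_* suc n) (length-select isSparse) ⟩
      ∑[ x < suc n ] 𝟙 (isSparse x) * suc n
    ≡⟨ *-distribʳ-sum (suc n) (𝟙 ∘ isSparse) ⟩
      ∑[ x < suc n ] (𝟙 (isSparse x) * suc n)
    ≤⟨ ∑-mono-≤ pointwise ⟩
      ∑[ x < suc n ] (2 * codeg x + 2)
    ≡⟨ ∑-distrib-+ (λ x → 2 * codeg x) (λ _ → 2) ⟩
      ∑[ x < suc n ] (2 * codeg x) + ∑[ x < suc n ] 2
    ≡⟨ cong₂ _+_ (sym (*-distribˡ-sum 2 codeg)) (∑-const (suc n) 2) ⟩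
      2 * ∑[ x < suc n ] codeg x + suc n * 2 ∎
    where
      open ≤-Reasoning
      isSparse : Fin (suc n) → Bool
      isSparse x = does (deg x ≤? codeg x + 1)
      pointwise : ∀ x → 𝟙 (isSparse x) * suc n ≤ 2 * codeg x + 2
      pointwise x = indicator (deg x ≤? codeg x + 1)
        where
          indicator : (d : Dec (Sparse x)) → 𝟙 (does d) * suc n ≤ 2 * codeg x + 2
          indicator (yes sp) =
            subst (_≤ 2 * codeg x + 2) (sym (*-identityˡ (suc n))) (sparse⇒N≤2codeg+2 sp)
          indicator (no  _)  = z≤n

  length-deficient*K : length deficient * K ≤ ∑[ x < suc n ] codeg x
  length-deficient*K = begin
      length deficient * K
    ≡⟨ cong (_* K) (length-select isDeficient) ⟩
      ∑[ x < suc n ] 𝟙 (isDeficient x) * K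
    ≡⟨ *-distribʳ-sum K (𝟙 ∘ isDeficient) ⟩
      ∑[ x < suc n ] (𝟙 (isDeficient x) * K)
    ≤⟨ ∑-mono-≤ pointwise ⟩
      ∑[ x < suc n ] codeg x ∎
    where
      open ≤-Reasoning
      isDeficient : Fin (suc n) → Bool
      isDeficient x = does (K ≤? codeg x)
      pointwise : ∀ x → 𝟙 (isDeficient x) * K ≤ codeg x
      pointwise x = indicator (K ≤? codeg x)
        where
          indicator : (d : Dec (K ≤ codeg x)) → 𝟙 (does d) * K ≤ codeg x
          indicator (yes K≤c) = subst (_≤ codeg x) (sym (*-identityˡ K)) K≤c
          indicator (no  _)   = z≤n

  length-exceptional : let t = length sparse ; q = length deficient in
                       length exceptional ≤ t + (t * K + (q + (t * q + q * t)))
  length-exceptional = begin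
      length exceptional
    ≡⟨ length-++ sparse ⟩
      t + length (neighbourhoods ++ farthests ++ commonNeighbours₁ ++ commonNeighbours₂)
    ≡⟨ cong (t +_) (length-++ neighbourhoods) ⟩
      t + (length neighbourhoods + length (farthests ++ commonNeighbours₁ ++ commonNeighbours₂))
    ≡⟨ cong (λ l → t + (length neighbourhoods + l)) (length-++ farthests) ⟩
      t + (length neighbourhoods + (length farthests + length (commonNeighbours₁ ++ commonNeighbours₂)))
    ≡⟨ cong (λ l → t + (length neighbourhoods + (length farthests + l))) (length-++ commonNeighbours₁) ⟩
      t + (length neighbourhoods + (length farthests + (length commonNeighbours₁ + length commonNeighbours₂)))
    ≤⟨ +-monoʳ-≤ t (+-mono-≤ (length-concatMap-≤ smallNeighbourhood short sparse)
         (≤-reflexive (cong₂ _+_ (length-map farthestFrom deficient)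
           (cong₂ _+_ (length-cartesianProductWith commonNeighbour sparse deficient)
                      (length-cartesianProductWith commonNeighbour deficient sparse))))) ⟩
      t + (t * K + (q + (t * q + q * t))) ∎
    where
      open ≤-Reasoning
      t q : ℕ
      t = length sparse
      q = length deficient
      short : ∀ x → length (smallNeighbourhood x) ≤ K
      short x with deg x ≤? K
      ... | yes low = subst (_≤ K) (sym (length-select (adj G x))) low
      ... | no  _   = z≤n

m+m≤n⇒k+k<n⇒m+k<n : ∀ {m k n} → m + m ≤ n → k + k < n → m + k < n
m+m≤n⇒k+k<n⇒m+k<n {m} {k} {n} m+m≤n k+k<n with m + k <? n
... | yes m+k<n = m+k<n
... | no  m+k≮n = contradiction (+-mono-≤-< m+m≤n k+k<n) (≤⇒≯ (begin
      n + n              ≤⟨ +-mono-≤ (≮⇒≥ m+k≮n) (≮⇒≥ m+k≮n) ⟩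
      m + k + (m + k)    ≡⟨ interchange m k ⟩
      m + m + (k + k)    ∎))
  where
    open ≤-Reasoning
    interchange : ∀ m k → m + k + (m + k) ≡ m + m + (k + k)
    interchange = solve-∀

sparseBound degreeBound baseBound : ℕ → ℕ
sparseBound a = 4 * a + 1
degreeBound a = 4 * a * (2 * sparseBound a + 1)
baseBound   a = 1 + sparseBound a * (degreeBound a + 1)

module Counting {n} (G : Graph (suc n)) (a : ℕ) (small-wiener : wiener G < suc n C 2 + a * suc n) where

  open Degrees G
  open Candidates G (degreeBound a)

  ∑codeg<2aN : ∑[ x < suc n ] codeg x < 2 * (a * suc n)
  ∑codeg<2aN = subst (_< 2 * (a * suc n)) (sym ∑codeg≡)
    (subst (nonEdges + nonEdges <_) (cong (a * suc n +_) (sym (+-identityʳ (a * suc n))))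
      (+-mono-< nonEdges<aN nonEdges<aN))
    where
      nonEdges<aN : nonEdges < a * suc n
      nonEdges<aN =
        +-cancelˡ-< (suc n C 2) nonEdges (a * suc n) (≤-<-trans C2+nonEdges≤wiener small-wiener)

  length-sparse≤ : length sparse ≤ sparseBound a
  length-sparse≤ = ≤-pred (subst (length sparse <_) (+-suc (4 * a) 1)
                            (*-cancelʳ-< (suc n) (length sparse) (4 * a + 2) (begin-strict
      length sparse * suc n                    ≤⟨ length-sparse*N ⟩
      2 * ∑[ x < suc n ] codeg x + suc n * 2   <⟨ +-monoˡ-< (suc n * 2) (*-monoʳ-< 2 ∑codeg<2aN) ⟩
      2 * (2 * (a * suc n)) + suc n * 2        ≡⟨ rearrange a (suc n) ⟩
      (4 * a + 2) * suc n                      ∎)))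
    where
      open ≤-Reasoning
      rearrange : ∀ a N → 2 * (2 * (a * N)) + N * 2 ≡ (4 * a + 2) * N
      rearrange = solve-∀

  deficient-bound : let q = length deficient * (2 * sparseBound a + 1) in q + q < suc n
  deficient-bound = *-cancelʳ-< (2 * a) (q + q) (suc n) (begin-strict
      (q + q) * (2 * a)                 ≡⟨ rearrange (length deficient) (2 * sparseBound a + 1) a ⟩
      length deficient * degreeBound a  ≤⟨ length-deficient*K ⟩
      ∑[ x < suc n ] codeg x            <⟨ ∑codeg<2aN ⟩
      2 * (a * suc n)                   ≡⟨ *-comm-2a a (suc n) ⟩
      suc n * (2 * a)                   ∎)
    where
      open ≤-Reasoning
      q : ℕ
      q = length deficient * (2 * sparseBound a + 1)
      rearrange : ∀ d s a → (d * s + d * s) * (2 * a) ≡ d * (4 * a * s)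
      rearrange = solve-∀
      *-comm-2a : ∀ a N → 2 * (a * N) ≡ N * (2 * a)
      *-comm-2a = solve-∀

  1+length-exceptional<N : baseBound a + baseBound a ≤ suc n → 1 + length exceptional < suc n
  1+length-exceptional<N M+M≤N = ≤-<-trans (begin
      1 + length exceptional
    ≤⟨ +-monoʳ-≤ 1 length-exceptional ⟩
      1 + (t + (t * K + (q + (t * q + q * t))))
    ≡⟨ rearrange t K q ⟩
      1 + t * (K + 1) + q * (2 * t + 1)
    ≤⟨ +-mono-≤ (+-monoʳ-≤ 1 (*-monoˡ-≤ (K + 1) length-sparse≤))
                (*-monoʳ-≤ q (+-monoˡ-≤ 1 (*-monoʳ-≤ 2 length-sparse≤))) ⟩
      baseBound a + q * (2 * sparseBound a + 1) ∎)
    (m+m≤n⇒k+k<n⇒m+k<n {baseBound a} {length deficient * (2 * sparseBound a + 1)}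
                        M+M≤N deficient-bound)
    where
      open ≤-Reasoning
      t q K : ℕ
      t = length sparse
      q = length deficient
      K = degreeBound a
      rearrange : ∀ t K q → 1 + (t + (t * K + (q + (t * q + q * t))))
                          ≡ 1 + t * (K + 1) + q * (2 * t + 1)
      rearrange = solve-∀

∃∉ : ∀ {n} (xs : List (Fin n)) → length xs < n → ∃ λ v → v ∉ xs
∃∉ {n} xs short = ¬∀⟶∃¬ n (_∈ xs) (λ v → DecMembership._∈?_ _≟_ v xs) λ all∈ →
  <⇒≱ short (injective⇒≤ {f = λ v → Any.index (all∈ v)} λ {u} {w} same →
    trans (lookup-index (all∈ u)) (trans (cong (lookup xs) same) (sym (lookup-index (all∈ w)))))

module Deletable {m} (G : Graph (suc (suc m))) (a r : ℕ) (3≤r : 3 ≤ r) (hr : HasRadius G r)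
                 (K+K≤N : degreeBound a + degreeBound a ≤ suc (suc m)) (r+r<m : r + r < suc m) where

  open Candidates G (degreeBound a)
  open HasRadius hr

  r≤ecc : ∀ u → r ≤ ecc G u
  r≤ecc u = subst (_≤ ecc G u) radius≡ (radius≤ecc G u)

  c : Fin (suc (suc m))
  c = proj₁ (centre G)

  ecc-c : ecc G c ≡ r
  ecc-c = trans (sym (proj₂ (centre G))) radius≡

  reaches-2r : ∀ u w → Reaches G (r + r) u w
  reaches-2r u w = reaches-trans (reaches-sym (from-centre u)) (from-centre w)
    where
      from-centre : ∀ u → Reaches G r c u
      from-centre u =
        reaches-mono d≤r (dist-reaches (≤-<-trans d≤r (≤-<-trans (m≤m+n r r) (m<n⇒m<1+n r+r<m))))
        where
          d≤r : dist G c u ≤ r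
          d≤r = subst (dist G c u ≤_) ecc-c (dist≤ecc G c u)

  module _ {v} (v∉ : v ∉ c ∷ exceptional) where

    open Deletion G v

    detourable : Detourable
    detourable p y pv vy ¬py
      with any? (λ w → (adj G (skip v p) (skip v w) ∧ adj G (skip v w) (skip v y)) Bool.≟ true)
    ... | yes (w , pwy) = w , ∧-elim pwy
    ... | no  none      =
      contradiction (there (unique-common-neighbour⇒exceptional K+K≤N pv vy ¬py unique)) v∉
      where
        unique : ∀ w → adj G (skip v p) w ≡ true → adj G w (skip v y) ≡ true → w ≡ v
        unique w pw wy with deleted? w
        ... | deleted = refl
        ... | kept w′ = contradiction (w′ , ∧-intro pw wy) none

    rival : ∀ x → ∃ λ y → dist G (skip v x) v ≤ dist G (skip v x) (skip v y)
    rival x with any? (λ y → dist G (skip v x) v ≤? dist G (skip v x) (skip v y))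
    ... | yes found = found
    ... | no  none  = contradiction
      (there (sole-farthest⇒exceptional K+K≤N {skip v x} (≤-trans 3≤r (r≤ecc (skip v x))) sole)) v∉
      where
        sole : ∀ w → w ≢ v → dist G (skip v x) w < dist G (skip v x) v
        sole w w≢v with deleted? w
        ... | deleted = contradiction refl w≢v
        ... | kept y  = ≰⇒> λ le → none (y , le)

    dist≡ : ∀ x y → dist (G ─ v) x y ≡ dist G (skip v x) (skip v y)
    dist≡ x y = dist-─ detourable r+r<m (reaches-2r (skip v x) (skip v y))

    hasRadius-─ : HasRadius (G ─ v) r
    hasRadius-─ = record
      { connected = connected-─ detourable connected
      ; radius≡   =
          trans (radius-─ G (λ c≡v → v∉ (here (sym c≡v))) (proj₂ (centre G)) (ecc-─ dist≡ rival)) radius≡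
      }

deletable-vertex : ∀ {n} (G : Graph n) (a r : ℕ) → 3 ≤ r → HasRadius G r → wiener G < n C 2 + a * n →
                   2 + (r + r) ≤ n → degreeBound a + degreeBound a ≤ n → baseBound a + baseBound a ≤ n →
                   ∃ λ v → HasRadius (G ─ v) r × (∀ x y → dist (G ─ v) x y ≡ dist G (skip v x) (skip v y))
deletable-vertex {suc (suc m)} G a r 3≤r hr small-wiener (s≤s (s≤s r+r≤m)) K+K≤N M+M≤N =
  let v , v∉ = ∃∉ (c ∷ exceptional) (1+length-exceptional<N M+M≤N) in v , hasRadius-─ v∉ , dist≡ v∉
  where
    open Deletable G a r 3≤r hr K+K≤N (s≤s r+r≤m)
    open Candidates G (degreeBound a) using (exceptional)
    open Counting G a small-wiener using (1+length-exceptional<N)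

lemma3 : (a r : ℕ) → 3 ≤ a → 3 ≤ r →
           ∃ λ (n₀ : ℕ) → ∀ (n : ℕ) → n₀ ≤ n → (G : Graph n) →
             HasRadius G r → wiener G < n C 2 + a * n →
             ∃ λ (v : Fin n) → HasRadius (G ─ v) r ×
               (∀ (x y : Fin (pred n)) → dist (G ─ v) x y ≡ dist G (skip v x) (skip v y))
lemma3 a r _ 3≤r = n₀ , λ n n₀≤n G hr small-wiener →
  deletable-vertex G a r 3≤r hr small-wiener
    (≤-trans (≤-trans (m≤m+n _ K+K) (m≤m+n _ M+M)) n₀≤n)
    (≤-trans (≤-trans (m≤n+m K+K (2 + (r + r))) (m≤m+n _ M+M)) n₀≤n)
    (≤-trans (m≤n+m M+M (2 + (r + r) + K+K)) n₀≤n)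
  where
    K+K M+M n₀ : ℕ
    K+K = degreeBound a + degreeBound a
    M+M = baseBound a + baseBound a
    n₀  = 2 + (r + r) + K+K + M+M
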